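{- Let $X\subseteq\mathbb N$ be a $\mathrm{BP}$ random set. For any increasing primitive recursive function $f$ and any $\epsilon>0$, \[\left|\frac{\mathrm{card}(X\cap[[f(n)]])}{f(n)}-\frac12\right|\le\epsilon\] holds for infinitely many $n$.
   Context: A set $X\subseteq\mathbb N$ is identified with its characteristic sequence in $\{0,1\}^\omega$. $[[m]]=\{0,1,\ldots,m-1\}$. For a string $\sigma$, $[\sigma]$ is the set of reals extending $\sigma$, and $[G]=\bigcup_{\sigma\in G}[\sigma]$. $\mu$ is the uniform measure. A primitive recursive test is a sequence of clopen sets $U_n=[G_n]$, with finite sets $G_n$ given by a primitive recursive function and $\mu(U_n)\le 2^{ -n}$. $X$ is $\mathrm{BP}$ random if for every primitive recursive test there is $n$ with $X\notin U_n$.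
   Formalization: The parameter ε ranges over the positive rationals. -}

module Defs where

open import Data.Nat using (ℕ; zero; suc; _+_; _*_; _^_; _≤_; _<_)
open import Data.Fin using (Fin)
open import Data.Vec using (Vec; []; _∷_; lookup)
open import Data.Bool using (Bool; true; false; _∧_; if_then_else_)
open import Data.List using (List; []; _∷_; length; map; _++_; foldr)
open import Data.Bool.ListAction using (any)
open import Data.Product using (Σ; ∃; _×_; _,_)
open import Data.Integer using (+_)
open import Data.Rational using (ℚ; 0ℚ; _/_)
open import Relation.Binary.PropositionalEquality using (_≡_)
open import Relation.Nullary using (¬_)

data PR : ℕ → Set where
  Z    : ∀ {n} → PR n
  S    : PR 1
  P    : ∀ {n} → Fin n → PR n
  C    : ∀ {m n} → PR m → Vec (PR n) m → PR n
  R    : ∀ {n} → PR n → PR (suc (suc n)) → PR (suc n)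

mutual
  eval : ∀ {n} → PR n → Vec ℕ n → ℕ
  eval Z       xs       = 0
  eval S       (x ∷ []) = suc x
  eval (P i)   xs       = lookup xs i
  eval (C g hs) xs      = eval g (evalAll hs xs)
  eval (R g h) (k ∷ xs) = evalRec g h k xs

  evalAll : ∀ {m n} → Vec (PR n) m → Vec ℕ n → Vec ℕ m
  evalAll []       xs = []
  evalAll (h ∷ hs) xs = eval h xs ∷ evalAll hs xs

  evalRec : ∀ {n} → PR n → PR (suc (suc n)) → ℕ → Vec ℕ n → ℕ
  evalRec g h zero    xs = eval g xs
  evalRec g h (suc k) xs = eval h (k ∷ evalRec g h k xs ∷ xs)

PrimRec : (ℕ → ℕ) → Set
PrimRec f = Σ (PR 1) λ e → ∀ n → eval e (n ∷ []) ≡ f n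

-- Coding finite sets (lists) of binary strings as natural numbers
-- (standard injective coding: [] ↦ 0, x ∷ xs ↦ 2^x * (2 * code xs + 1))

codeBool : Bool → ℕ
codeBool false = 0
codeBool true  = 1

codeList : {A : Set} → (A → ℕ) → List A → ℕ
codeList c []       = 0
codeList c (x ∷ xs) = 2 ^ c x * (2 * codeList c xs + 1)

codeStr : List Bool → ℕ
codeStr = codeList codeBool

codeG : List (List Bool) → ℕ
codeG = codeList codeStr

PrimRecSeq : (ℕ → List (List Bool)) → Set
PrimRecSeq G = Σ (PR 1) λ e → ∀ n → eval e (n ∷ []) ≡ codeG (G n)

Real : Set
Real = ℕ → Bool

_↾_ : Real → ℕ → List Bool
X ↾ zero  = []
X ↾ suc m = (X ↾ m) ++ (X m ∷ [])

_∈cyl_ : Real → List Bool → Set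
X ∈cyl σ = X ↾ length σ ≡ σ

_∈[_] : Real → List (List Bool) → Set
X ∈[ G ] = Σ (List Bool) λ σ → (σ Data.List.Membership.Propositional.∈ G) × (X ∈cyl σ)
  where import Data.List.Membership.Propositional

-- Measure of the clopen set [G]: with L the maximal length of a string
-- in G, μ([G]) = #{τ ∈ {0,1}^L : τ extends some σ ∈ G} / 2^L.

bitEq : Bool → Bool → Bool
bitEq true  true  = true
bitEq false false = true
bitEq _     _     = false

isPrefix : List Bool → List Bool → Bool
isPrefix []      _        = true
isPrefix (a ∷ σ) []       = false
isPrefix (a ∷ σ) (b ∷ τ)  = bitEq a b ∧ isPrefix σ τ

strings : ℕ → List (List Bool)
strings zero    = [] ∷ []
strings (suc L) = map (false ∷_) (strings L) ++ map (true ∷_) (strings L)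

maxLen : List (List Bool) → ℕ
maxLen = foldr (λ σ m → Data.Nat._⊔_ (length σ) m) 0

countTrue : List Bool → ℕ
countTrue = foldr (λ b k → if b then suc k else k) 0

cylCount : List (List Bool) → ℕ
cylCount G = countTrue (map (λ τ → any (λ σ → isPrefix σ τ) G) (strings (maxLen G)))

-- μ([G]) ≤ 2^{-n}, i.e. cylCount G / 2^L ≤ 2^{-n}
MeasureBound : List (List Bool) → ℕ → Set
MeasureBound G n = cylCount G * 2 ^ n ≤ 2 ^ maxLen G

PRTest : (ℕ → List (List Bool)) → Set
PRTest G = PrimRecSeq G × (∀ n → MeasureBound (G n) n)

BPRandom : Real → Set
BPRandom X = ∀ G → PRTest G → Σ ℕ λ n → ¬ (X ∈[ G n ])

card : Real → ℕ → ℕ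
card X zero    = 0
card X (suc m) = (if X m then suc (card X m) else card X m)

-- k / m as a rational (convention: 0 when m = 0; only used with m > 0)
ratio : ℕ → ℕ → ℚ
ratio k zero    = 0ℚ
ratio k (suc m) = (+ k) / suc m

Increasing : (ℕ → ℕ) → Set
Increasing f = ∀ m n → m < n → f m < f n

-- Write ε = p/q and call a string of length L unbalanced when p·2L < q·|2k − L|, k its number
-- of ones, i.e. when |k/L − 1/2| > ε.  The second moment Σ_{|τ|=L} (2k − L)² = L·2^L and
-- Chebyshev's inequality leave at most q²·2^L/L unbalanced strings.  With L_m = f(N + q²·2^m)
-- the unbalanced strings of length L_m therefore have measure at most 2^-m, and they form a
-- primitive recursive test: enumerate all numbers below 2^L_m in binary and keep those whose
-- digits are unbalanced.  The BP random X escapes some level m of this test, so X ↾ L_m is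
-- balanced, which is the claim for n = N + q²·2^m ≥ N.
module Submission where

open import Defs
open import Data.Nat using (ℕ; _≤_; _<_)
open import Data.Product using (Σ; _×_)
open import Data.Rational using (ℚ; Positive; ½; _-_; ∣_∣) renaming (_≤_ to _≤ℚ_)

open import Data.Bool using (Bool; true; false; if_then_else_; T; T?)
open import Data.Bool.ListAction using (any)
open import Data.Bool.Properties using (if-float)
open import Data.Empty using (⊥-elim)
open import Data.Fin using (Fin)
open import Data.Fin.Patterns using (0F; 1F; 2F; 3F)
open import Data.Integer as ℤ using (_⊖_; +[1+_])
import Data.Integer.Properties as ℤ
open import Data.List using (List; []; _∷_; length; map; foldr; _++_; downFrom; filterᵇ)
open import Data.List.Membership.Propositional using (_∈_)
open import Data.List.Membership.Propositional.Properties using (∈-map⁺; ∈-map⁻; ∈-filter⁺; ∈-filter⁻; ∈-downFrom⁺)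
open import Data.List.Properties using (map-++; map-∘; map-cong; length-++; length-map)
open import Data.List.Relation.Unary.All as All using (All; []; _∷_)
import Data.List.Relation.Unary.All.Properties as All
open import Data.List.Relation.Unary.Any.Properties using (any⁻)
open import Data.Nat as ℕ using (zero; suc; _+_; _*_; _∸_; _^_; _<ᵇ_; ⌊_/2⌋; pred; z≤n; s≤s; NonZero; >-nonZero; >-nonZero⁻¹)
open import Data.Nat.Coprimality using (Coprime)
open import Data.Nat.GeneralisedArithmetic using (fold)
open import Data.Nat.ListAction using (sum)
open import Data.Nat.ListAction.Properties using (sum-++)
open import Data.Nat.Properties
open import Algebra.Properties.CommutativeSemigroup +-commutativeSemigroup using (interchange)
open import Data.Nat.Tactic.RingSolver using (solve-∀)
open import Data.Product using (_,_; proj₁; proj₂)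
open import Data.Rational using (-_; mkℚ; toℚᵘ)
import Data.Rational.Properties as ℚ
open import Data.Rational.Unnormalised as ℚᵘ using (mkℚᵘ)
import Data.Rational.Unnormalised.Properties as ℚᵘ
open import Data.Sum using (inj₁; inj₂)
open import Data.Vec using (Vec; []; _∷_; lookup; head)
open import Function using (_∘_)
open import Relation.Binary.PropositionalEquality
open import Relation.Nullary using (¬_)

-- Primitive recursive arithmetic

-- A record rather than a Π-type so that unification can read e and f off a proof:
-- eval itself is stuck on a metavariable.
record _computes_ {n} (e : PR n) (f : Vec ℕ n → ℕ) : Set where
  constructor pointwise
  field at : ∀ xs → eval e xs ≡ f xs
open _computes_

private variable
  A : Set
  n : ℕ
  a b c e : PR n
  f g h : Vec ℕ n → ℕ

P-computes : (i : Fin n) → P i computes (λ xs → lookup xs i)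
P-computes i = pointwise λ xs → refl

S-computes : S computes λ { (x ∷ []) → suc x }
S-computes = pointwise λ { (x ∷ []) → refl }

lit : ℕ → PR n
lit zero    = Z
lit (suc k) = C S (lit k ∷ [])

lit-computes : ∀ k → lit {n} k computes (λ _ → k)
lit-computes zero    = pointwise λ xs → refl
lit-computes (suc k) = pointwise λ xs → cong suc (at (lit-computes k) xs)

C₁-computes : {φ : Vec ℕ 1 → ℕ} → e computes φ → a computes f →
              C e (a ∷ []) computes (λ xs → φ (f xs ∷ []))
C₁-computes {e = e} {a = a} e≈φ a≈f = pointwise λ xs →
  trans (cong (λ x → eval e (x ∷ [])) (at a≈f xs)) (at e≈φ _)

C₂-computes : {φ : Vec ℕ 2 → ℕ} → e computes φ → a computes f → b computes g →
              C e (a ∷ b ∷ []) computes (λ xs → φ (f xs ∷ g xs ∷ []))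
C₂-computes {e = e} {a = a} {b = b} e≈φ a≈f b≈g = pointwise λ xs →
  trans (cong₂ (λ x y → eval e (x ∷ y ∷ [])) (at a≈f xs) (at b≈g xs)) (at e≈φ _)

plus : PR 2
plus = R (P 0F) (C S (P 1F ∷ []))

plus-computes : plus computes λ { (x ∷ y ∷ []) → x + y }
plus-computes = pointwise λ { (x ∷ y ∷ []) → eval-plus x y }
  where
  eval-plus : ∀ x y → eval plus (x ∷ y ∷ []) ≡ x + y
  eval-plus zero    y = refl
  eval-plus (suc x) y = cong suc (eval-plus x y)

infixl 6 _+ᴾ_ _∸ᴾ_
infixl 7 _*ᴾ_
infix  8 2^ᴾ_
infix  4 _<ᴾ_

_+ᴾ_ : PR n → PR n → PR n
a +ᴾ b = C plus (a ∷ b ∷ [])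

+ᴾ-computes : a computes f → b computes g → (a +ᴾ b) computes (λ xs → f xs + g xs)
+ᴾ-computes = C₂-computes plus-computes

times : PR 2
times = R Z (P 2F +ᴾ P 1F)

times-computes : times computes λ { (x ∷ y ∷ []) → x * y }
times-computes = pointwise λ { (x ∷ y ∷ []) → eval-times x y }
  where
  eval-times : ∀ x y → eval times (x ∷ y ∷ []) ≡ x * y
  eval-times zero    y = refl
  eval-times (suc x) y =
    trans (at (+ᴾ-computes (P-computes 2F) (P-computes 1F)) (x ∷ eval times (x ∷ y ∷ []) ∷ y ∷ []))
          (cong (y +_) (eval-times x y))

_*ᴾ_ : PR n → PR n → PR n
a *ᴾ b = C times (a ∷ b ∷ [])

*ᴾ-computes : a computes f → b computes g → (a *ᴾ b) computes (λ xs → f xs * g xs)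
*ᴾ-computes = C₂-computes times-computes

pow2 : PR 1
pow2 = R (lit 1) (lit 2 *ᴾ P 1F)

pow2-computes : pow2 computes λ { (x ∷ []) → 2 ^ x }
pow2-computes = pointwise λ { (x ∷ []) → eval-pow2 x }
  where
  eval-pow2 : ∀ x → eval pow2 (x ∷ []) ≡ 2 ^ x
  eval-pow2 zero    = refl
  eval-pow2 (suc x) =
    trans (at (*ᴾ-computes (lit-computes 2) (P-computes 1F)) (x ∷ eval pow2 (x ∷ []) ∷ []))
          (cong (2 *_) (eval-pow2 x))

2^ᴾ_ : PR n → PR n
2^ᴾ a = C pow2 (a ∷ [])

2^ᴾ-computes : a computes f → (2^ᴾ a) computes (λ xs → 2 ^ f xs)
2^ᴾ-computes = C₁-computes pow2-computes

monus : PR 2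
monus = R (P 0F) (C (R Z (P 0F)) (P 1F ∷ []))

monus-computes : monus computes λ { (k ∷ x ∷ []) → x ∸ k }
monus-computes = pointwise λ { (k ∷ x ∷ []) → eval-monus k x }
  where
  eval-monus : ∀ k x → eval monus (k ∷ x ∷ []) ≡ x ∸ k
  eval-monus zero    x = refl
  eval-monus (suc k) x = begin
    eval monus (suc k ∷ x ∷ [])    ≡⟨ eval-pred (eval monus (k ∷ x ∷ [])) ⟩
    pred (eval monus (k ∷ x ∷ [])) ≡⟨ cong pred (eval-monus k x) ⟩
    pred (x ∸ k)                   ≡⟨ pred[m∸n]≡m∸[1+n] x k ⟩
    x ∸ suc k                      ∎
    where
    open ≡-Reasoning
    eval-pred : ∀ y → eval (R Z (P 0F)) (y ∷ []) ≡ pred y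
    eval-pred zero    = refl
    eval-pred (suc y) = refl

_∸ᴾ_ : PR n → PR n → PR n
a ∸ᴾ b = C monus (b ∷ a ∷ [])

∸ᴾ-computes : a computes f → b computes g → (a ∸ᴾ b) computes (λ xs → f xs ∸ g xs)
∸ᴾ-computes a≈f b≈g = C₂-computes monus-computes b≈g a≈f

∣m-n∣≡[m∸n]+[n∸m] : ∀ m n → ℕ.∣ m - n ∣ ≡ (m ∸ n) + (n ∸ m)
∣m-n∣≡[m∸n]+[n∸m] zero    n       = cong (_+ n) (sym (0∸n≡0 n))
∣m-n∣≡[m∸n]+[n∸m] (suc m) zero    = sym (+-identityʳ (suc m))
∣m-n∣≡[m∸n]+[n∸m] (suc m) (suc n) = ∣m-n∣≡[m∸n]+[n∸m] m n

∣_-_∣ᴾ : PR n → PR n → PR n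
∣ a - b ∣ᴾ = (a ∸ᴾ b) +ᴾ (b ∸ᴾ a)

∣-∣ᴾ-computes : a computes f → b computes g → ∣ a - b ∣ᴾ computes (λ xs → ℕ.∣ f xs - g xs ∣)
∣-∣ᴾ-computes {f = f} {g = g} a≈f b≈g = pointwise λ xs →
  trans (at (+ᴾ-computes (∸ᴾ-computes a≈f b≈g) (∸ᴾ-computes b≈g a≈f)) xs)
        (sym (∣m-n∣≡[m∸n]+[n∸m] (f xs) (g xs)))

codeBool-<ᵇ : ∀ m n → codeBool (m <ᵇ n) ≡ 1 ∸ (1 ∸ (n ∸ m))
codeBool-<ᵇ zero    zero    = refl
codeBool-<ᵇ zero    (suc n) = cong (1 ∸_) (sym (0∸n≡0 n))
codeBool-<ᵇ (suc m) zero    = refl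
codeBool-<ᵇ (suc m) (suc n) = codeBool-<ᵇ m n

_<ᴾ_ : PR n → PR n → PR n
a <ᴾ b = lit 1 ∸ᴾ (lit 1 ∸ᴾ (b ∸ᴾ a))

<ᴾ-computes : a computes f → b computes g → (a <ᴾ b) computes (λ xs → codeBool (f xs <ᵇ g xs))
<ᴾ-computes {f = f} {g = g} a≈f b≈g = pointwise λ xs →
  trans (at (∸ᴾ-computes (lit-computes 1) (∸ᴾ-computes (lit-computes 1) (∸ᴾ-computes b≈g a≈f))) xs)
        (sym (codeBool-<ᵇ (f xs) (g xs)))

ifᴾ_then_else_ : PR n → PR n → PR n → PR n
ifᴾ c then a else b = (c *ᴾ a) +ᴾ ((lit 1 ∸ᴾ c) *ᴾ b)

ifᴾ-computes : (β : Vec ℕ n → Bool) → c computes (λ xs → codeBool (β xs)) →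
               a computes f → b computes g →
               (ifᴾ c then a else b) computes (λ xs → if β xs then f xs else g xs)
ifᴾ-computes {f = f} {g = g} β c≈β a≈f b≈g = pointwise λ xs →
  trans (at (+ᴾ-computes (*ᴾ-computes c≈β a≈f) (*ᴾ-computes (∸ᴾ-computes (lit-computes 1) c≈β) b≈g)) xs)
        (select (β xs) (f xs) (g xs))
  where
  select : ∀ β x y → codeBool β * x + (1 ∸ codeBool β) * y ≡ (if β then x else y)
  select false x y = +-identityʳ y
  select true  x y = trans (+-identityʳ (x + 0)) (+-identityʳ x)

-- Binary digits and their primitive recursive enumeration

odd : ℕ → Bool
odd zero          = false
odd (suc zero)    = true
odd (suc (suc n)) = odd n

codeBool-odd-suc : ∀ n → codeBool (odd (suc n)) ≡ 1 ∸ codeBool (odd n)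
codeBool-odd-suc zero          = refl
codeBool-odd-suc (suc zero)    = refl
codeBool-odd-suc (suc (suc n)) = codeBool-odd-suc n

⌊1+n/2⌋≡⌊n/2⌋+odd[n] : ∀ n → ⌊ suc n /2⌋ ≡ ⌊ n /2⌋ + codeBool (odd n)
⌊1+n/2⌋≡⌊n/2⌋+odd[n] zero          = refl
⌊1+n/2⌋≡⌊n/2⌋+odd[n] (suc zero)    = refl
⌊1+n/2⌋≡⌊n/2⌋+odd[n] (suc (suc n)) = cong suc (⌊1+n/2⌋≡⌊n/2⌋+odd[n] n)

oddᴾ : PR 1
oddᴾ = R Z (lit 1 ∸ᴾ P 1F)

oddᴾ-computes : oddᴾ computes λ { (x ∷ []) → codeBool (odd x) }
oddᴾ-computes = pointwise λ { (x ∷ []) → eval-odd x }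
  where
  eval-odd : ∀ x → eval oddᴾ (x ∷ []) ≡ codeBool (odd x)
  eval-odd zero    = refl
  eval-odd (suc x) = begin
    eval oddᴾ (suc x ∷ [])     ≡⟨ at (∸ᴾ-computes (lit-computes 1) (P-computes 1F)) (x ∷ eval oddᴾ (x ∷ []) ∷ []) ⟩
    1 ∸ eval oddᴾ (x ∷ [])     ≡⟨ cong (1 ∸_) (eval-odd x) ⟩
    1 ∸ codeBool (odd x)       ≡⟨ codeBool-odd-suc x ⟨
    codeBool (odd (suc x))     ∎
    where open ≡-Reasoning

halfᴾ : PR 1
halfᴾ = R Z (P 1F +ᴾ C oddᴾ (P 0F ∷ []))

halfᴾ-computes : halfᴾ computes λ { (x ∷ []) → ⌊ x /2⌋ }
halfᴾ-computes = pointwise λ { (x ∷ []) → eval-half x }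
  where
  eval-half : ∀ x → eval halfᴾ (x ∷ []) ≡ ⌊ x /2⌋
  eval-half zero    = refl
  eval-half (suc x) = begin
    eval halfᴾ (suc x ∷ [])                  ≡⟨ at (+ᴾ-computes (P-computes 1F) (C₁-computes oddᴾ-computes (P-computes 0F)))
                                                   (x ∷ eval halfᴾ (x ∷ []) ∷ []) ⟩
    eval halfᴾ (x ∷ []) + codeBool (odd x)   ≡⟨ cong (_+ codeBool (odd x)) (eval-half x) ⟩
    ⌊ x /2⌋ + codeBool (odd x)               ≡⟨ ⌊1+n/2⌋≡⌊n/2⌋+odd[n] x ⟨
    ⌊ suc x /2⌋                              ∎
    where open ≡-Reasoning

halvingsᴾ : PR 2
halvingsᴾ = R (P 0F) (C halfᴾ (P 1F ∷ []))

halvingsᴾ-computes : halvingsᴾ computes λ { (t ∷ x ∷ []) → fold x ⌊_/2⌋ t }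
halvingsᴾ-computes = pointwise λ { (t ∷ x ∷ []) → eval-halvings t x }
  where
  eval-halvings : ∀ t x → eval halvingsᴾ (t ∷ x ∷ []) ≡ fold x ⌊_/2⌋ t
  eval-halvings zero    x = refl
  eval-halvings (suc t) x =
    trans (at (C₁-computes halfᴾ-computes (P-computes 1F)) (t ∷ eval halvingsᴾ (t ∷ x ∷ []) ∷ x ∷ []))
          (cong ⌊_/2⌋ (eval-halvings t x))

-- the L lowest binary digits of i, least significant first
bits : ℕ → ℕ → List Bool
bits zero    i = []
bits (suc L) i = odd i ∷ bits L ⌊ i /2⌋

length-bits : ∀ L i → length (bits L i) ≡ L
length-bits zero    i = refl
length-bits (suc L) i = cong suc (length-bits L ⌊ i /2⌋)

fromBits : List Bool → ℕ
fromBits []      = 0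
fromBits (b ∷ τ) = codeBool b + fromBits τ * 2

odd[b+n*2]≡b : ∀ b n → odd (codeBool b + n * 2) ≡ b
odd[b+n*2]≡b false zero    = refl
odd[b+n*2]≡b true  zero    = refl
odd[b+n*2]≡b false (suc n) = odd[b+n*2]≡b false n
odd[b+n*2]≡b true  (suc n) = odd[b+n*2]≡b true n

⌊b+n*2/2⌋≡n : ∀ b n → ⌊ codeBool b + n * 2 /2⌋ ≡ n
⌊b+n*2/2⌋≡n false zero    = refl
⌊b+n*2/2⌋≡n true  zero    = refl
⌊b+n*2/2⌋≡n false (suc n) = cong suc (⌊b+n*2/2⌋≡n false n)
⌊b+n*2/2⌋≡n true  (suc n) = cong suc (⌊b+n*2/2⌋≡n true n)

bits-fromBits : ∀ τ → bits (length τ) (fromBits τ) ≡ τ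
bits-fromBits []      = refl
bits-fromBits (b ∷ τ) = cong₂ _∷_ (odd[b+n*2]≡b b (fromBits τ))
  (trans (cong (bits (length τ)) (⌊b+n*2/2⌋≡n b (fromBits τ))) (bits-fromBits τ))

fromBits<2^length : ∀ τ → fromBits τ < 2 ^ length τ
fromBits<2^length []      = s≤s z≤n
fromBits<2^length (b ∷ τ) = begin-strict
  codeBool b + fromBits τ * 2 <⟨ +-monoˡ-< (fromBits τ * 2) (codeBool<2 b) ⟩
  2 + fromBits τ * 2          ≡⟨ *-comm (suc (fromBits τ)) 2 ⟩
  2 * suc (fromBits τ)        ≤⟨ *-monoʳ-≤ 2 (fromBits<2^length τ) ⟩
  2 * 2 ^ length τ            ∎
  where
  open ≤-Reasoning
  codeBool<2 : ∀ b → codeBool b < 2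
  codeBool<2 false = s≤s z≤n
  codeBool<2 true  = s≤s (s≤s z≤n)

digitᴾ : PR 3
digitᴾ = C oddᴾ (C halvingsᴾ ((P 1F ∸ᴾ C S (P 0F ∷ [])) ∷ P 2F ∷ []) ∷ [])

digitᴾ-computes : digitᴾ computes λ { (j ∷ L ∷ i ∷ []) → codeBool (odd (fold i ⌊_/2⌋ (L ∸ suc j))) }
digitᴾ-computes = pointwise λ { xs@(_ ∷ _ ∷ _ ∷ []) →
  at (C₁-computes oddᴾ-computes (C₂-computes halvingsᴾ-computes
       (∸ᴾ-computes (P-computes 1F) (C₁-computes S-computes (P-computes 0F))) (P-computes 2F))) xs }

-- foldr consumes a list from its end, so the recursion on j folds the last j of the L digits.
suffixFoldᴾ : PR 2 → PR 3
suffixFoldᴾ h = R Z (C h (C digitᴾ (P 0F ∷ P 2F ∷ P 3F ∷ []) ∷ P 1F ∷ []))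

foldrBitsᴾ : PR 2 → PR 2
foldrBitsᴾ h = C (suffixFoldᴾ h) (P 0F ∷ P 0F ∷ P 1F ∷ [])

module _ {h : PR 2} (step : Bool → ℕ → ℕ)
         (h-step : ∀ β acc → eval h (codeBool β ∷ acc ∷ []) ≡ step β acc) where

  private
    eval-suffixFoldᴾ : ∀ j L i → j ≤ L →
      eval (suffixFoldᴾ h) (j ∷ L ∷ i ∷ []) ≡ foldr step 0 (bits j (fold i ⌊_/2⌋ (L ∸ j)))
    eval-suffixFoldᴾ zero    L i _   = refl
    eval-suffixFoldᴾ (suc j) L i j<L = begin
      eval (suffixFoldᴾ h) (suc j ∷ L ∷ i ∷ [])
        ≡⟨ cong (λ β → eval h (β ∷ acc ∷ [])) (at digitᴾ-computes (j ∷ L ∷ i ∷ [])) ⟩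
      eval h (codeBool (odd y) ∷ acc ∷ [])
        ≡⟨ h-step (odd y) acc ⟩
      step (odd y) acc
        ≡⟨ cong (step (odd y)) (eval-suffixFoldᴾ j L i (<⇒≤ j<L)) ⟩
      step (odd y) (foldr step 0 (bits j (fold i ⌊_/2⌋ (L ∸ j))))
        ≡⟨ cong (λ t → step (odd y) (foldr step 0 (bits j (fold i ⌊_/2⌋ t)))) (+-∸-assoc 1 j<L) ⟩
      foldr step 0 (bits (suc j) y)
        ∎
      where
      open ≡-Reasoning
      acc y : ℕ
      acc = eval (suffixFoldᴾ h) (j ∷ L ∷ i ∷ [])
      y = fold i ⌊_/2⌋ (L ∸ suc j)

  foldrBitsᴾ-computes : foldrBitsᴾ h computes λ { (L ∷ i ∷ []) → foldr step 0 (bits L i) }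
  foldrBitsᴾ-computes = pointwise λ { (L ∷ i ∷ []) →
    trans (eval-suffixFoldᴾ L L i ≤-refl) (cong (λ t → foldr step 0 (bits L (fold i ⌊_/2⌋ t))) (n∸n≡0 L)) }

codeList-foldr : {A : Set} (c : A → ℕ) (xs : List A) →
                 codeList c xs ≡ foldr (λ x acc → 2 ^ c x * (2 * acc + 1)) 0 xs
codeList-foldr c []       = refl
codeList-foldr c (x ∷ xs) = cong (λ acc → 2 ^ c x * (2 * acc + 1)) (codeList-foldr c xs)

codeStrBitsᴾ : PR 2
codeStrBitsᴾ = foldrBitsᴾ (2^ᴾ P 0F *ᴾ (lit 2 *ᴾ P 1F +ᴾ lit 1))

eval-codeStrBitsᴾ : ∀ L i → eval codeStrBitsᴾ (L ∷ i ∷ []) ≡ codeStr (bits L i)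
eval-codeStrBitsᴾ L i =
  trans (at (foldrBitsᴾ-computes _ λ β acc → at step-computes (codeBool β ∷ acc ∷ [])) (L ∷ i ∷ []))
        (sym (codeList-foldr codeBool (bits L i)))
  where
  step-computes : (2^ᴾ P 0F *ᴾ (lit 2 *ᴾ P 1F +ᴾ lit 1)) computes λ xs → 2 ^ lookup xs 0F * (2 * lookup xs 1F + 1)
  step-computes = *ᴾ-computes (2^ᴾ-computes (P-computes 0F))
                    (+ᴾ-computes (*ᴾ-computes (lit-computes 2) (P-computes 1F)) (lit-computes 1))

countTrueBitsᴾ : PR 2
countTrueBitsᴾ = foldrBitsᴾ (P 0F +ᴾ P 1F)

countTrueBitsᴾ-computes : countTrueBitsᴾ computes λ { (L ∷ i ∷ []) → countTrue (bits L i) }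
countTrueBitsᴾ-computes = pointwise λ { xs@(_ ∷ _ ∷ []) →
  at (foldrBitsᴾ-computes (λ β acc → if β then suc acc else acc) λ { false acc → refl ; true acc → refl }) xs }

filterᵇ-∷ : {A : Set} (p : A → Bool) (x : A) (xs : List A) →
           filterᵇ p (x ∷ xs) ≡ (if p x then x ∷ filterᵇ p xs else filterᵇ p xs)
filterᵇ-∷ p x xs with p x
... | true  = refl
... | false = refl

filterCodesᴾ : PR 2 → PR 2 → PR 2
filterCodesᴾ c d =
  R Z (ifᴾ C d (P 2F ∷ P 0F ∷ []) then 2^ᴾ C c (P 2F ∷ P 0F ∷ []) *ᴾ (lit 2 *ᴾ P 1F +ᴾ lit 1) else P 1F)

module _ {c d : PR 2} (s : ℕ → ℕ → List Bool) (D : ℕ → ℕ → Bool)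
         (c-code : ∀ L i → eval c (L ∷ i ∷ []) ≡ codeStr (s L i))
         (d-decides : ∀ L i → eval d (L ∷ i ∷ []) ≡ codeBool (D L i)) where

  private
    c-computes : c computes λ { (L ∷ i ∷ []) → codeStr (s L i) }
    c-computes = pointwise λ { (L ∷ i ∷ []) → c-code L i }

    d-computes : d computes λ { (L ∷ i ∷ []) → codeBool (D L i) }
    d-computes = pointwise λ { (L ∷ i ∷ []) → d-decides L i }

    eval-filterCodesᴾ : ∀ j L →
      eval (filterCodesᴾ c d) (j ∷ L ∷ []) ≡ codeG (map (s L) (filterᵇ (D L) (downFrom j)))
    eval-filterCodesᴾ zero    L = refl
    eval-filterCodesᴾ (suc j) L = begin
      eval (filterCodesᴾ c d) (suc j ∷ L ∷ [])
        ≡⟨ at (ifᴾ-computes (λ xs → D (lookup xs 2F) (lookup xs 0F))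
                 (C₂-computes d-computes (P-computes 2F) (P-computes 0F))
                 (*ᴾ-computes (2^ᴾ-computes (C₂-computes c-computes (P-computes 2F) (P-computes 0F)))
                              (+ᴾ-computes (*ᴾ-computes (lit-computes 2) (P-computes 1F)) (lit-computes 1)))
                 (P-computes 1F))
              (j ∷ acc ∷ L ∷ []) ⟩
      (if D L j then 2 ^ codeStr (s L j) * (2 * acc + 1) else acc)
        ≡⟨ cong (λ a → if D L j then 2 ^ codeStr (s L j) * (2 * a + 1) else a) (eval-filterCodesᴾ j L) ⟩
      (if D L j then codeG (map (s L) (j ∷ rest)) else codeG (map (s L) rest))
        ≡⟨ if-float (codeG ∘ map (s L)) (D L j) ⟨
      codeG (map (s L) (if D L j then j ∷ rest else rest))
        ≡⟨ cong (codeG ∘ map (s L)) (filterᵇ-∷ (D L) j (downFrom j)) ⟨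
      codeG (map (s L) (filterᵇ (D L) (downFrom (suc j))))
        ∎
      where
      open ≡-Reasoning
      acc : ℕ
      acc = eval (filterCodesᴾ c d) (j ∷ L ∷ [])
      rest : List ℕ
      rest = filterᵇ (D L) (downFrom j)

  filterCodesᴾ-computes : filterCodesᴾ c d computes λ { (j ∷ L ∷ []) → codeG (map (s L) (filterᵇ (D L) (downFrom j))) }
  filterCodesᴾ-computes = pointwise λ { (j ∷ L ∷ []) → eval-filterCodesᴾ j L }

-- The unbalanced strings form a primitive recursive sequence

-- |k/L − 1/2| > p/q with the denominators cleared
unbalanced : ℕ → ℕ → ℕ → ℕ → Bool
unbalanced p q L k = p * (L * 2) <ᵇ q * ℕ.∣ k * 2 - L ∣

unbalancedStrings : ℕ → ℕ → ℕ → List (List Bool)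
unbalancedStrings p q L =
  map (bits L) (filterᵇ (λ i → unbalanced p q L (countTrue (bits L i))) (downFrom (2 ^ L)))

unbalancedBitsᴾ : ℕ → ℕ → PR 2
unbalancedBitsᴾ p q = C (lit p *ᴾ (P 0F *ᴾ lit 2) <ᴾ lit q *ᴾ ∣ P 1F *ᴾ lit 2 - P 0F ∣ᴾ) (P 0F ∷ countTrueBitsᴾ ∷ [])

eval-unbalancedBitsᴾ : ∀ p q L i → eval (unbalancedBitsᴾ p q) (L ∷ i ∷ []) ≡ codeBool (unbalanced p q L (countTrue (bits L i)))
eval-unbalancedBitsᴾ p q L i =
  at (C₂-computes (<ᴾ-computes (*ᴾ-computes (lit-computes p) (*ᴾ-computes (P-computes 0F) (lit-computes 2)))
                               (*ᴾ-computes (lit-computes q) (∣-∣ᴾ-computes (*ᴾ-computes (P-computes 1F) (lit-computes 2)) (P-computes 0F))))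
                  (P-computes 0F) countTrueBitsᴾ-computes)
     (L ∷ i ∷ [])

PrimRec-∘ : ∀ {f g} → PrimRec f → PrimRec g → PrimRec (f ∘ g)
PrimRec-∘ {f} {g} (e , e-f) (e′ , e′-g) =
  C e (e′ ∷ []) , λ n → trans (cong (λ x → eval e (x ∷ [])) (e′-g n)) (e-f (g n))

PrimRec-+*2^ : ∀ a c → PrimRec (λ m → a + c * 2 ^ m)
PrimRec-+*2^ a c = lit a +ᴾ lit c *ᴾ 2^ᴾ P 0F ,
  λ m → at (+ᴾ-computes (lit-computes a) (*ᴾ-computes (lit-computes c) (2^ᴾ-computes (P-computes 0F)))) (m ∷ [])

unbalancedStrings-PrimRecSeq : ∀ p q {F} → PrimRec F → PrimRecSeq (unbalancedStrings p q ∘ F)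
unbalancedStrings-PrimRecSeq p q {F} (e , e-F) =
  C (filterCodesᴾ codeStrBitsᴾ (unbalancedBitsᴾ p q)) (2^ᴾ e ∷ e ∷ []) ,
  λ m → at (C₂-computes (filterCodesᴾ-computes bits (λ L i → unbalanced p q L (countTrue (bits L i)))
                                               eval-codeStrBitsᴾ (eval-unbalancedBitsᴾ p q))
                        (2^ᴾ-computes e-computes) e-computes)
           (m ∷ [])
  where
  e-computes : e computes (λ xs → F (head xs))
  e-computes = pointwise λ { (x ∷ []) → e-F x }


-- Counting unbalanced strings

countTrue-map-*-≤-sum : (p : A → Bool) (g : A → ℕ) (t : ℕ) (xs : List A) →
                        All (λ x → T (p x) → t ≤ g x) xs → countTrue (map p xs) * t ≤ sum (map g xs)
countTrue-map-*-≤-sum p g t []       []       = z≤n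
countTrue-map-*-≤-sum p g t (x ∷ xs) (h ∷ hs) with p x
... | true  = +-mono-≤ (h _) (countTrue-map-*-≤-sum p g t xs hs)
... | false = ≤-trans (countTrue-map-*-≤-sum p g t xs hs) (m≤n+m _ (g x))

countTrue-map-mono : (p q : A → Bool) (xs : List A) →
                     All (λ x → T (p x) → T (q x)) xs → countTrue (map p xs) ≤ countTrue (map q xs)
countTrue-map-mono p q []       []       = z≤n
countTrue-map-mono p q (x ∷ xs) (h ∷ hs) with p x | q x
... | true  | true  = s≤s (countTrue-map-mono p q xs hs)
... | true  | false = ⊥-elim (h _)
... | false | true  = m≤n⇒m≤1+n (countTrue-map-mono p q xs hs)
... | false | false = countTrue-map-mono p q xs hs

sum-map-+ : (f g : A → ℕ) (xs : List A) → sum (map (λ x → f x + g x) xs) ≡ sum (map f xs) + sum (map g xs)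
sum-map-+ f g []       = refl
sum-map-+ f g (x ∷ xs) =
  trans (cong (f x + g x +_) (sum-map-+ f g xs)) (interchange (f x) (g x) (sum (map f xs)) (sum (map g xs)))

sum-map-* : (c : ℕ) (f : A → ℕ) (xs : List A) → sum (map (λ x → c * f x) xs) ≡ c * sum (map f xs)
sum-map-* c f []       = sym (*-zeroʳ c)
sum-map-* c f (x ∷ xs) = trans (cong (c * f x +_) (sum-map-* c f xs)) (sym (*-distribˡ-+ c (f x) _))

sum-map-1 : (xs : List A) → sum (map (λ _ → 1) xs) ≡ length xs
sum-map-1 []       = refl
sum-map-1 (x ∷ xs) = cong suc (sum-map-1 xs)

sum-map-strings-suc : (g : List Bool → ℕ) (L : ℕ) →
  sum (map g (strings (suc L))) ≡ sum (map (λ τ → g (false ∷ τ) + g (true ∷ τ)) (strings L))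
sum-map-strings-suc g L = begin
  sum (map g (map (false ∷_) τs ++ map (true ∷_) τs))
    ≡⟨ cong sum (map-++ g (map (false ∷_) τs) _) ⟩
  sum (map g (map (false ∷_) τs) ++ map g (map (true ∷_) τs))
    ≡⟨ sum-++ (map g (map (false ∷_) τs)) _ ⟩
  sum (map g (map (false ∷_) τs)) + sum (map g (map (true ∷_) τs))
    ≡⟨ cong₂ _+_ (cong sum (map-∘ τs)) (cong sum (map-∘ τs)) ⟨
  sum (map (g ∘ (false ∷_)) τs) + sum (map (g ∘ (true ∷_)) τs)
    ≡⟨ sum-map-+ (g ∘ (false ∷_)) (g ∘ (true ∷_)) τs ⟨
  sum (map (λ τ → g (false ∷ τ) + g (true ∷ τ)) τs)
    ∎
  where
  open ≡-Reasoning
  τs : List (List Bool)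
  τs = strings L

length-strings : ∀ L → length (strings L) ≡ 2 ^ L
length-strings zero    = refl
length-strings (suc L) = begin
  length (map (false ∷_) τs ++ map (true ∷_) τs)      ≡⟨ length-++ (map (false ∷_) τs) ⟩
  length (map (false ∷_) τs) + length (map (true ∷_) τs) ≡⟨ cong₂ _+_ (length-map _ τs) (length-map _ τs) ⟩
  length τs + length τs                               ≡⟨ cong (λ n → n + n) (length-strings L) ⟩
  2 ^ L + 2 ^ L                                       ≡⟨ cong (2 ^ L +_) (+-identityʳ (2 ^ L)) ⟨
  2 ^ suc L                                           ∎
  where
  open ≡-Reasoning
  τs : List (List Bool)
  τs = strings L

strings-length : ∀ L → All (λ τ → length τ ≡ L) (strings L)
strings-length zero    = refl ∷ []
strings-length (suc L) = All.++⁺ (All.map⁺ (All.map (cong suc) (strings-length L)))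
                                 (All.map⁺ (All.map (cong suc) (strings-length L)))

n²+[2+n]²≡2[[1+n]²+1] : ∀ n → n * n + (2 + n) * (2 + n) ≡ 2 * ((1 + n) * (1 + n) + 1)
n²+[2+n]²≡2[[1+n]²+1] = solve-∀

∣m-1+n∣²+∣1+m-n∣² : ∀ m n →
  ℕ.∣ m - suc n ∣ * ℕ.∣ m - suc n ∣ + ℕ.∣ suc m - n ∣ * ℕ.∣ suc m - n ∣ ≡ 2 * (ℕ.∣ m - n ∣ * ℕ.∣ m - n ∣ + 1)
∣m-1+n∣²+∣1+m-n∣² zero          zero    = refl
∣m-1+n∣²+∣1+m-n∣² zero          (suc n) = trans (+-comm (suc (suc n) * suc (suc n)) (n * n)) (n²+[2+n]²≡2[[1+n]²+1] n)
∣m-1+n∣²+∣1+m-n∣² (suc zero)    zero    = refl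
∣m-1+n∣²+∣1+m-n∣² (suc (suc m)) zero    = n²+[2+n]²≡2[[1+n]²+1] (suc m)
∣m-1+n∣²+∣1+m-n∣² (suc m)       (suc n) = ∣m-1+n∣²+∣1+m-n∣² m n

deviation : List Bool → ℕ
deviation τ = ℕ.∣ countTrue τ * 2 - length τ ∣

sum-deviation² : ∀ L → sum (map (λ τ → deviation τ * deviation τ) (strings L)) ≡ L * 2 ^ L
sum-deviation² zero    = refl
sum-deviation² (suc L) = begin
  sum (map dev² (strings (suc L)))
    ≡⟨ sum-map-strings-suc dev² L ⟩
  sum (map (λ τ → dev² (false ∷ τ) + dev² (true ∷ τ)) τs)
    ≡⟨ cong sum (map-cong (λ τ → ∣m-1+n∣²+∣1+m-n∣² (countTrue τ * 2) (length τ)) τs) ⟩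
  sum (map (λ τ → 2 * (dev² τ + 1)) τs)
    ≡⟨ sum-map-* 2 (λ τ → dev² τ + 1) τs ⟩
  2 * sum (map (λ τ → dev² τ + 1) τs)
    ≡⟨ cong (2 *_) (sum-map-+ dev² (λ _ → 1) τs) ⟩
  2 * (sum (map dev² τs) + sum (map (λ _ → 1) τs))
    ≡⟨ cong₂ (λ a b → 2 * (a + b)) (sum-deviation² L) (trans (sum-map-1 τs) (length-strings L)) ⟩
  2 * (L * 2 ^ L + 2 ^ L)
    ≡⟨ distrib L (2 ^ L) ⟩
  suc L * 2 ^ suc L
    ∎
  where
  open ≡-Reasoning
  τs : List (List Bool)
  τs = strings L
  dev² : List Bool → ℕ
  dev² τ = deviation τ * deviation τ
  distrib : ∀ L x → 2 * (L * x + x) ≡ suc L * (2 * x)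
  distrib = solve-∀

unbalancedCount : ℕ → ℕ → ℕ → ℕ
unbalancedCount p q L = countTrue (map (λ τ → unbalanced p q L (countTrue τ)) (strings L))

unbalancedCount-chebyshev : ∀ p q L →
  unbalancedCount p q L * (p * (L * 2) * (p * (L * 2))) ≤ q * q * (L * 2 ^ L)
unbalancedCount-chebyshev p q L = begin
  unbalancedCount p q L * (w * w)
    ≤⟨ countTrue-map-*-≤-sum _ qdev² (w * w) (strings L) (All.map (λ {τ} → square-bound {τ}) (strings-length L)) ⟩
  sum (map qdev² (strings L))
    ≡⟨ cong sum (map-cong (λ τ → square-* q (deviation τ)) (strings L)) ⟩
  sum (map (λ τ → q * q * (deviation τ * deviation τ)) (strings L))
    ≡⟨ sum-map-* (q * q) _ (strings L) ⟩
  q * q * sum (map (λ τ → deviation τ * deviation τ) (strings L))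
    ≡⟨ cong (q * q *_) (sum-deviation² L) ⟩
  q * q * (L * 2 ^ L)
    ∎
  where
  open ≤-Reasoning
  w : ℕ
  w = p * (L * 2)
  qdev² : List Bool → ℕ
  qdev² τ = q * deviation τ * (q * deviation τ)
  square-bound : ∀ {τ} → length τ ≡ L → T (unbalanced p q L (countTrue τ)) → w * w ≤ qdev² τ
  square-bound {τ} refl unb = let w≤qd = <⇒≤ (<ᵇ⇒< w (q * deviation τ) unb) in *-mono-≤ w≤qd w≤qd
  square-* : ∀ a b → a * b * (a * b) ≡ a * a * (b * b)
  square-* = solve-∀

0<q*q*2^m : ∀ q m .{{_ : NonZero q}} → 0 < q * q * 2 ^ m
0<q*q*2^m q m = >-nonZero⁻¹ (q * q * 2 ^ m) {{m*n≢0 (q * q) (2 ^ m) {{m*n≢0 q q}} {{m^n≢0 2 m}}}}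

unbalancedCount-bound : ∀ p q L m .{{_ : NonZero p}} .{{_ : NonZero q}} → q * q * 2 ^ m ≤ L →
                        unbalancedCount p q L * 2 ^ m ≤ 2 ^ L
unbalancedCount-bound p q L m q²2^m≤L = *-cancelˡ-≤ (q * q) (begin
  q * q * (count * 2 ^ m)  ≡⟨ swap (q * q) count (2 ^ m) ⟩
  count * (q * q * 2 ^ m)  ≤⟨ *-monoʳ-≤ count q²2^m≤L ⟩
  count * L                ≤⟨ *-cancelʳ-≤ (count * L) (q * q * 2 ^ L) L countL²≤q²2^LL ⟩
  q * q * 2 ^ L            ∎)
  where
  open ≤-Reasoning
  count : ℕ
  count = unbalancedCount p q L
  w : ℕ
  w = p * (L * 2)
  instance
    q²-nonZero : NonZero (q * q)
    q²-nonZero = m*n≢0 q q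
    L-nonZero : NonZero L
    L-nonZero = >-nonZero (<-≤-trans (0<q*q*2^m q m) q²2^m≤L)
  swap : ∀ a b c → a * (b * c) ≡ b * (a * c)
  swap = solve-∀
  L≤w : L ≤ w
  L≤w = ≤-trans (m≤m*n L 2) (m≤n*m (L * 2) p)
  countL²≤q²2^LL : count * L * L ≤ q * q * 2 ^ L * L
  countL²≤q²2^LL = begin
    count * L * L        ≡⟨ *-assoc count L L ⟩
    count * (L * L)      ≤⟨ *-monoʳ-≤ count (*-mono-≤ L≤w L≤w) ⟩
    count * (w * w)      ≤⟨ unbalancedCount-chebyshev p q L ⟩
    q * q * (L * 2 ^ L)  ≡⟨ swap (q * q) L (2 ^ L) ⟩
    L * (q * q * 2 ^ L)  ≡⟨ *-comm L (q * q * 2 ^ L) ⟩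
    q * q * 2 ^ L * L    ∎

-- The test and the theorem

isPrefix-≡ : ∀ σ τ → T (isPrefix σ τ) → length σ ≡ length τ → σ ≡ τ
isPrefix-≡ []          []          _   _   = refl
isPrefix-≡ (true ∷ σ)  (true ∷ τ)  σ⊑τ len = cong (true ∷_) (isPrefix-≡ σ τ σ⊑τ (suc-injective len))
isPrefix-≡ (false ∷ σ) (false ∷ τ) σ⊑τ len = cong (false ∷_) (isPrefix-≡ σ τ σ⊑τ (suc-injective len))

maxLen-≤ : ∀ {L} G → All (λ σ → length σ ≤ L) G → maxLen G ≤ L
maxLen-≤ []      []           = z≤n
maxLen-≤ (σ ∷ G) (len ∷ lens) = ⊔-lub len (maxLen-≤ G lens)

maxLen-uniform : ∀ {L} σ G → All (λ σ → length σ ≡ L) (σ ∷ G) → maxLen (σ ∷ G) ≡ L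
maxLen-uniform σ G (refl ∷ lens) = m≥n⇒m⊔n≡m (maxLen-≤ G (All.map ≤-reflexive lens))

measureBound-uniform : ∀ {L m} (p : List Bool → Bool) G →
  All (λ σ → length σ ≡ L × T (p σ)) G →
  countTrue (map p (strings L)) * 2 ^ m ≤ 2 ^ L → MeasureBound G m
measureBound-uniform p []       _   _     = z≤n
measureBound-uniform {L} {m} p G@(σ ∷ G′) hyp bound = begin
  countTrue (map covers (strings (maxLen G))) * 2 ^ m
    ≡⟨ cong (λ M → countTrue (map covers (strings M)) * 2 ^ m) maxLen≡L ⟩
  countTrue (map covers (strings L)) * 2 ^ m
    ≤⟨ *-monoˡ-≤ (2 ^ m) (countTrue-map-mono covers p (strings L) (All.map covers⇒p (strings-length L))) ⟩
  countTrue (map p (strings L)) * 2 ^ m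
    ≤⟨ bound ⟩
  2 ^ L
    ≡⟨ cong (2 ^_) maxLen≡L ⟨
  2 ^ maxLen G
    ∎
  where
  open ≤-Reasoning
  covers : List Bool → Bool
  covers τ = any (λ σ → isPrefix σ τ) G
  maxLen≡L : maxLen G ≡ L
  maxLen≡L = maxLen-uniform σ G′ (All.map proj₁ hyp)
  covers⇒p : ∀ {τ} → length τ ≡ L → T (covers τ) → T (p τ)
  covers⇒p {τ} len cov = All.lookupWith
    (λ { {σ} (lenσ , pσ) σ⊑τ → subst (T ∘ p) (isPrefix-≡ σ τ σ⊑τ (trans lenσ (sym len))) pσ })
    hyp (any⁻ _ G cov)

countTrue-∷ʳ : ∀ τ b → countTrue (τ ++ b ∷ []) ≡ (if b then suc (countTrue τ) else countTrue τ)
countTrue-∷ʳ []          false = refl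
countTrue-∷ʳ []          true  = refl
countTrue-∷ʳ (false ∷ τ) b     = countTrue-∷ʳ τ b
countTrue-∷ʳ (true ∷ τ)  b     = trans (cong suc (countTrue-∷ʳ τ b)) (if-suc b)
  where
  if-suc : ∀ b {m n} → suc (if b then m else n) ≡ (if b then suc m else suc n)
  if-suc true  = refl
  if-suc false = refl

card≡countTrue : ∀ X L → card X L ≡ countTrue (X ↾ L)
card≡countTrue X zero    = refl
card≡countTrue X (suc L) rewrite countTrue-∷ʳ (X ↾ L) (X L) | card≡countTrue X L = refl

length-↾ : ∀ X L → length (X ↾ L) ≡ L
length-↾ X zero    = refl
length-↾ X (suc L) = trans (length-++ (X ↾ L)) (trans (cong (_+ 1) (length-↾ X L)) (+-comm L 1))

module _ {p q L : ℕ} {σ : List Bool} where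

  private
    unbalancedAt : ℕ → Bool
    unbalancedAt i = unbalanced p q L (countTrue (bits L i))

  ∈-unbalancedStrings⁻ : σ ∈ unbalancedStrings p q L → length σ ≡ L × T (unbalanced p q L (countTrue σ))
  ∈-unbalancedStrings⁻ σ∈ with i , i∈ , refl ← ∈-map⁻ (bits L) σ∈ =
    length-bits L i , proj₂ (∈-filter⁻ (T? ∘ unbalancedAt) {xs = downFrom (2 ^ L)} i∈)

  ∈-unbalancedStrings⁺ : length σ ≡ L → T (unbalanced p q L (countTrue σ)) → σ ∈ unbalancedStrings p q L
  ∈-unbalancedStrings⁺ refl unb = subst (_∈ unbalancedStrings p q L) (bits-fromBits σ)
    (∈-map⁺ (bits L) (∈-filter⁺ (T? ∘ unbalancedAt) (∈-downFrom⁺ (fromBits<2^length σ))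
      (subst (λ τ → T (unbalanced p q L (countTrue τ))) (sym (bits-fromBits σ)) unb)))

∣m⊖n∣≡∣m-n∣ : ∀ m n → ℤ.∣ m ⊖ n ∣ ≡ ℕ.∣ m - n ∣
∣m⊖n∣≡∣m-n∣ m n with ≤-total m n
... | inj₁ m≤n = trans (ℤ.∣⊖∣-≤ m≤n) (sym (m≤n⇒∣m-n∣≡n∸m m≤n))
... | inj₂ n≤m = trans (ℤ.∣m⊖n∣≡∣n⊖m∣ m n) (trans (ℤ.∣⊖∣-≤ n≤m) (trans (sym (m≤n⇒∣m-n∣≡n∸m n≤m)) (∣-∣-comm n m)))

∣ratio-½∣≤ : ∀ k L p q′ .(c : Coprime p (suc q′)) → 0 < L →
             suc q′ * ℕ.∣ k * 2 - L ∣ ≤ p * (L * 2) → ∣ ratio k L - ½ ∣ ≤ℚ mkℚ (ℤ.+ p) q′ c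
∣ratio-½∣≤ k L@(suc L′) p q′ c _ h =
  ℚ.toℚᵘ-cancel-≤ (ℚᵘ.≤-respˡ-≃ (ℚᵘ.≃-sym unnormalise) (ℚᵘ.*≤* num-ineq))
  where
  open import Data.Integer using (+_)
  unnormalise : toℚᵘ ∣ ratio k L - ½ ∣ ℚᵘ.≃ ℚᵘ.∣ mkℚᵘ (+ k) L′ ℚᵘ.- ℚᵘ.½ ∣
  unnormalise = ℚᵘ.≃-trans (ℚ.toℚᵘ-homo-∣-∣ (ratio k L - ½))
    (ℚᵘ.∣-∣-cong (ℚᵘ.≃-trans (ℚ.toℚᵘ-homo-+ (ratio k L) (- ½))
                             (ℚᵘ.+-cong (ℚ.toℚᵘ-fromℚᵘ (mkℚᵘ (+ k) L′)) (ℚ.toℚᵘ-homo‿- ½))))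
  numerator : ℤ.∣ + k ℤ.* + 2 ℤ.+ ℤ.-1ℤ ℤ.* + L ∣ ≡ ℕ.∣ k * 2 - L ∣
  numerator = begin
    ℤ.∣ + k ℤ.* + 2 ℤ.+ ℤ.-1ℤ ℤ.* + L ∣  ≡⟨ cong₂ (λ a b → ℤ.∣ a ℤ.+ b ∣) (sym (ℤ.pos-* k 2)) (ℤ.-1*i≡-i (+ L)) ⟩
    ℤ.∣ + (k * 2) ℤ.- + L ∣              ≡⟨ cong ℤ.∣_∣ (ℤ.m-n≡m⊖n (k * 2) L) ⟩
    ℤ.∣ (k * 2) ⊖ L ∣                   ≡⟨ ∣m⊖n∣≡∣m-n∣ (k * 2) L ⟩
    ℕ.∣ k * 2 - L ∣                     ∎
    where open ≡-Reasoning
  num-ineq : + ℤ.∣ + k ℤ.* + 2 ℤ.+ ℤ.-1ℤ ℤ.* + L ∣ ℤ.* + suc q′ ℤ.≤ + p ℤ.* + (L * 2)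
  num-ineq = subst₂ ℤ._≤_ (trans (ℤ.pos-* dev (suc q′)) (cong (λ d → + d ℤ.* + suc q′) (sym numerator)))
                          (ℤ.pos-* p (L * 2))
                          (ℤ.+≤+ (subst (_≤ p * (L * 2)) (*-comm (suc q′) dev) h))
    where
    dev : ℕ
    dev = ℕ.∣ k * 2 - L ∣

∉unbalancedStrings⇒balanced : ∀ p q X L → ¬ (X ∈[ unbalancedStrings p q L ]) →
                               q * ℕ.∣ card X L * 2 - L ∣ ≤ p * (L * 2)
∉unbalancedStrings⇒balanced p q X L X∉ = ≮⇒≥ λ unb →
  X∉ (X ↾ L , ∈-unbalancedStrings⁺ {p} {q} (length-↾ X L)
                (<⇒<ᵇ (subst (λ k → p * (L * 2) < q * ℕ.∣ k * 2 - L ∣) (card≡countTrue X L) unb)) ,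
      cong (X ↾_) (length-↾ X L))

unbalancedStrings-MeasureBound : ∀ p q L m .{{_ : NonZero p}} .{{_ : NonZero q}} → q * q * 2 ^ m ≤ L →
                                 MeasureBound (unbalancedStrings p q L) m
unbalancedStrings-MeasureBound p q L m q²2^m≤L =
  measureBound-uniform {L} {m} (λ τ → unbalanced p q L (countTrue τ)) (unbalancedStrings p q L)
    (All.tabulate (∈-unbalancedStrings⁻ {p} {q} {L})) (unbalancedCount-bound p q L m q²2^m≤L)

n≤f[n] : ∀ {f} → Increasing f → ∀ n → n ≤ f n
n≤f[n] f-inc zero    = z≤n
n≤f[n] f-inc (suc n) = ≤-trans (s≤s (n≤f[n] f-inc n)) (f-inc n (suc n) ≤-refl)

q*q*2^m≤f[N+q*q*2^m] : ∀ {f} → Increasing f → ∀ q N m → q * q * 2 ^ m ≤ f (N + q * q * 2 ^ m)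
q*q*2^m≤f[N+q*q*2^m] f-inc q N m = ≤-trans (m≤n+m _ N) (n≤f[n] f-inc _)

unbalancedStrings-PRTest : ∀ p q .{{_ : NonZero p}} .{{_ : NonZero q}} {f} → Increasing f → PrimRec f → ∀ N →
                           PRTest (λ m → unbalancedStrings p q (f (N + q * q * 2 ^ m)))
unbalancedStrings-PRTest p q f-inc f-primRec N =
  unbalancedStrings-PrimRecSeq p q (PrimRec-∘ f-primRec (PrimRec-+*2^ N (q * q))) ,
  λ m → unbalancedStrings-MeasureBound p q _ m (q*q*2^m≤f[N+q*q*2^m] f-inc q N m)

theorem2p10 : (X : Real) → BPRandom X → (f : ℕ → ℕ) → Increasing f → PrimRec f →
    (ε : ℚ) → Positive ε →
    (N : ℕ) → Σ ℕ λ n → (N ≤ n) × (0 < f n) × (∣ ratio (card X (f n)) (f n) - ½ ∣ ≤ℚ ε)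
-- Positive ε rules out the other numerators, so this clause covers all cases.
theorem2p10 X X-random f f-inc f-primRec (mkℚ +[1+ p′ ] q′ c) _ N =
  index m , m≤m+n N _ , 0<f[index[m]] ,
  ∣ratio-½∣≤ (card X (f (index m))) (f (index m)) p q′ c 0<f[index[m]] (∉unbalancedStrings⇒balanced p q X _ X∉G[m])
  where
  p q : ℕ
  p = suc p′
  q = suc q′
  index : ℕ → ℕ
  index m = N + q * q * 2 ^ m
  escape : Σ ℕ λ m → ¬ (X ∈[ unbalancedStrings p q (f (index m)) ])
  escape = X-random _ (unbalancedStrings-PRTest p q f-inc f-primRec N)
  m : ℕ
  m = proj₁ escape
  X∉G[m] : ¬ (X ∈[ unbalancedStrings p q (f (index m)) ])
  X∉G[m] = proj₂ escape
  0<f[index[m]] : 0 < f (index m)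
  0<f[index[m]] = <-≤-trans (0<q*q*2^m q m) (q*q*2^m≤f[N+q*q*2^m] f-inc q N m)
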